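{- Let $M=(ST,AC,out_{AG},L)$ be a grand-coalition-first action model with determined outcome functions $\{out_C\}_{C\subseteq AG}$, and let $s\in ST$. The following three conditions are equivalent: (1) for all $a\in AG$ and $\sigma_a,\sigma'_a\in JA_{\{a\}}$, if $\sigma_a\neq\sigma'_a$ then $out_{\{a\}}(s,\sigma_a)\cap out_{\{a\}}(s,\sigma'_a)=\emptyset$; (2) for all $C\subseteq AG$ and $\sigma_C,\sigma'_C\in JA_C$, if $\sigma_C\neq\sigma'_C$ then $out_C(s,\sigma_C)\cap out_C(s,\sigma'_C)=\emptyset$; (3) for all $\sigma_{AG},\sigma'_{AG}\in JA_{AG}$, if $\sigma_{AG}\neq\sigma'_{AG}$ then $out_{AG}(s,\sigma_{AG})\cap out_{AG}(s,\sigma'_{AG})=\emptyset$.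
   Context: $AG$ is a finite nonempty set of agents, $AP$ a countable set of atomic propositions. For a nonempty set $AC$ and $C\subseteq AG$, $JA_C$ is the set of functions $\sigma_C:C\to AC$ ($JA_\emptyset=\{\emptyset\}$); $\sigma_C\subseteq\sigma_{AG}$ means $\sigma_C$ is the restriction of $\sigma_{AG}$ to $C$. A grand-coalition-first action model is $(ST,AC,out_{AG},L)$ with $ST,AC$ nonempty sets, $out_{AG}:ST\times JA_{AG}\to\mathcal P(ST)$, $L:ST\to\mathcal P(AP)$; its determined outcome functions are $out_C(s,\sigma_C)=\bigcup\{out_{AG}(s,\sigma_{AG})\mid\sigma_{AG}\in JA_{AG},\sigma_C\subseteq\sigma_{AG}\}$. -}

module Defs where

open import Data.Nat using (ℕ; suc)
open import Data.Fin using (Fin)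
open import Data.Fin.Subset using (Subset; _∈_; ⁅_⁆)
open import Data.Product using (Σ; _×_)
open import Relation.Binary.PropositionalEquality using (_≡_)
open import Relation.Nullary using (¬_)

Agent : ℕ → Set
Agent n = Fin (suc n)

Pow : Set → Set₁
Pow X = X → Set

Disjoint : {X : Set} → Pow X → Pow X → Set
Disjoint {X} A B = (x : X) → ¬ (A x × B x)

JA : (n : ℕ) → Set → Subset (suc n) → Set
JA n AC C = (a : Agent n) → a ∈ C → AC

JAG : ℕ → Set → Set
JAG n AC = Agent n → AC

_≐_ : {n : ℕ} {AC : Set} {C : Subset (suc n)} → JA n AC C → JA n AC C → Set
_≐_ {n} {C = C} σ σ' = (a : Agent n) (p : a ∈ C) → σ a p ≡ σ' a p

_≐G_ : {n : ℕ} {AC : Set} → JAG n AC → JAG n AC → Set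
_≐G_ {n} σ σ' = (a : Agent n) → σ a ≡ σ' a

_⊑_ : {n : ℕ} {AC : Set} {C : Subset (suc n)} → JA n AC C → JAG n AC → Set
_⊑_ {n} {C = C} σC σ = (a : Agent n) (p : a ∈ C) → σC a p ≡ σ a

record GCFModel (n : ℕ) (AP : Set) : Set₁ where
  field
    ST    : Set
    AC    : Set
    st₀   : ST
    ac₀   : AC
    outAG : ST → JAG n AC → Pow ST
    L     : ST → Pow AP

  out : (C : Subset (suc n)) → ST → JA n AC C → Pow ST
  out C s σC t = Σ (JAG n AC) (λ σ → σC ⊑ σ × outAG s σ t)

  Cond1 : ST → Set
  Cond1 s = (a : Agent n) (σ σ' : JA n AC ⁅ a ⁆) →
            ¬ (σ ≐ σ') → Disjoint (out ⁅ a ⁆ s σ) (out ⁅ a ⁆ s σ')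

  Cond2 : ST → Set
  Cond2 s = (C : Subset (suc n)) (σ σ' : JA n AC C) →
            ¬ (σ ≐ σ') → Disjoint (out C s σ) (out C s σ')

  Cond3 : ST → Set
  Cond3 s = (σ σ' : JAG n AC) →
            ¬ (σ ≐G σ') → Disjoint (outAG s σ) (outAG s σ')

{-# OPTIONS --safe #-}
module Submission where

-- Conditions (2) and (3) are equivalent because a common outcome of two coalition actions
-- comes from two grand-coalition actions extending them, and conversely a grand-coalition
-- action is the coalition action of AG.  Condition (1) implies (3) agent by agent: a common
-- outcome of σ and σ' refutes σ a ≢ σ' a for each agent a.  Constructively this only gives
-- ¬ ¬ (σ a ≡ σ' a), and it is the finiteness of AG that lets double negation commute with
-- the quantifier over agents, contradicting ¬ (σ ≐G σ').

open import Defs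
open import Data.Nat using (ℕ; suc)
open import Data.Fin using (Fin)
open import Data.Fin.Properties using (sequence)
open import Data.Fin.Subset using (Subset; ⊤; ⁅_⁆)
open import Data.Fin.Subset.Properties using (∈⊤; x∈⁅x⁆)
open import Data.Product using (_×_; _,_)
open import Effect.Monad using (RawMonad)
open import Function using (_∘_)
open import Function.Bundles using (_⇔_; mk⇔)
open import Relation.Binary.PropositionalEquality using (_≡_; refl; sym; trans)
open import Relation.Nullary using (¬_)
open import Relation.Nullary.Negation using (¬¬-Monad)

¬¬-∀-Fin : ∀ {m} {P : Fin m → Set} → (∀ i → ¬ ¬ P i) → ¬ ¬ (∀ i → P i)
¬¬-∀-Fin = sequence (RawMonad.rawApplicative ¬¬-Monad)

module _ {n : ℕ} {AC : Set} where

  restrict : (C : Subset (suc n)) → JAG n AC → JA n AC C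
  restrict C σ a _ = σ a

  restrict-⊑ : (C : Subset (suc n)) (σ : JAG n AC) → restrict C σ ⊑ σ
  restrict-⊑ C σ _ _ = refl

  ⊑-respects-≐G : {C : Subset (suc n)} {σC σC′ : JA n AC C} {σ σ′ : JAG n AC} →
                  σC ⊑ σ → σC′ ⊑ σ′ → σ ≐G σ′ → σC ≐ σC′
  ⊑-respects-≐G σC⊑σ σC′⊑σ′ σ≐σ′ a a∈C =
    trans (σC⊑σ a a∈C) (trans (σ≐σ′ a) (sym (σC′⊑σ′ a a∈C)))

  restrict-⊤-reflects-≐G : {σ σ′ : JAG n AC} → restrict ⊤ σ ≐ restrict ⊤ σ′ → σ ≐G σ′
  restrict-⊤-reflects-≐G eq a = eq a ∈⊤

module Conditions {n : ℕ} {AP : Set} (M : GCFModel n AP) (s : GCFModel.ST M) where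
  open GCFModel M

  outAG⊆out : (C : Subset (suc n)) {σ : JAG n AC} {t : ST} →
              outAG s σ t → out C s (restrict C σ) t
  outAG⊆out C {σ} t∈outAG = σ , restrict-⊑ C σ , t∈outAG

  Cond2⇒Cond1 : Cond2 s → Cond1 s
  Cond2⇒Cond1 cond2 a = cond2 ⁅ a ⁆

  Cond3⇒Cond2 : Cond3 s → Cond2 s
  Cond3⇒Cond2 cond3 C σC σC′ σC≉σC′ t ((σ , σC⊑σ , t∈σ) , (σ′ , σC′⊑σ′ , t∈σ′)) =
    cond3 σ σ′ (σC≉σC′ ∘ ⊑-respects-≐G σC⊑σ σC′⊑σ′) t (t∈σ , t∈σ′)

  Cond2⇒Cond3 : Cond2 s → Cond3 s
  Cond2⇒Cond3 cond2 σ σ′ σ≉σ′ t (t∈σ , t∈σ′) =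
    cond2 ⊤ (restrict ⊤ σ) (restrict ⊤ σ′) (σ≉σ′ ∘ restrict-⊤-reflects-≐G) t
      (outAG⊆out ⊤ t∈σ , outAG⊆out ⊤ t∈σ′)

  Cond1⇒Cond3 : Cond1 s → Cond3 s
  Cond1⇒Cond3 cond1 σ σ′ σ≉σ′ t (t∈σ , t∈σ′) = ¬¬-∀-Fin agrees-at σ≉σ′
    where
    agrees-at : (a : Agent n) → ¬ ¬ (σ a ≡ σ′ a)
    agrees-at a σa≢σ′a =
      cond1 a (restrict ⁅ a ⁆ σ) (restrict ⁅ a ⁆ σ′) (λ eq → σa≢σ′a (eq a (x∈⁅x⁆ a))) t
        (outAG⊆out ⁅ a ⁆ t∈σ , outAG⊆out ⁅ a ⁆ t∈σ′)

theorem5p2 : (n : ℕ) (AP : Set) (M : GCFModel n AP) (s : GCFModel.ST M) →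
    (GCFModel.Cond1 M s ⇔ GCFModel.Cond2 M s) × (GCFModel.Cond2 M s ⇔ GCFModel.Cond3 M s)
theorem5p2 n AP M s =
  mk⇔ (Cond3⇒Cond2 ∘ Cond1⇒Cond3) Cond2⇒Cond1 , mk⇔ Cond2⇒Cond3 Cond3⇒Cond2
  where open Conditions M s
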